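{- Let $n\ge 3$ and let $S=\{x_1,\ldots,x_n\}$ be a set of distinct positive integers such that $\gcd(x_i,x_j)=x_1$ for all distinct $i,j\in\{1,\ldots,n-1\}$ and $\operatorname{lcm}(x_1,\ldots,x_{n-1})\mid x_n$. Then the LCM matrix $[S]$, whose $(i,j)$ entry is $\operatorname{lcm}(x_i,x_j)$, is invertible. -}

module Defs where

open import Data.Nat using (ℕ; zero; suc)
open import Data.Nat.LCM using (lcm)
open import Data.Fin using (Fin; zero; suc)
open import Data.Integer using (+_)
open import Data.Rational using (ℚ; _/_; 0ℚ; 1ℚ; _+_; _*_)
open import Relation.Binary.PropositionalEquality using (_≡_)

Matrix : ℕ → Set
Matrix n = Fin n → Fin n → ℚ

toℚ : ℕ → ℚ
toℚ m = + m / 1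

sumFin : ∀ {n} → (Fin n → ℚ) → ℚ
sumFin {zero}  f = 0ℚ
sumFin {suc n} f = f zero + sumFin (λ i → f (suc i))

_⊗_ : ∀ {n} → Matrix n → Matrix n → Matrix n
(A ⊗ B) i j = sumFin (λ k → A i k * B k j)

δ : ∀ {n} → Fin n → Fin n → ℚ
δ zero    zero    = 1ℚ
δ zero    (suc j) = 0ℚ
δ (suc i) zero    = 0ℚ
δ (suc i) (suc j) = δ i j

identity : ∀ {n} → Matrix n
identity = δ

record Invertible {n : ℕ} (A : Matrix n) : Set where
  field
    inverse : Matrix n
    left    : ∀ i j → (inverse ⊗ A) i j ≡ identity i j
    right   : ∀ i j → (A ⊗ inverse) i j ≡ identity i j

lcmMatrix : ∀ {n} → (Fin n → ℕ) → Matrix n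
lcmMatrix x i j = toℚ (lcm (x i) (x j))

lcmFin : ∀ {k} → (Fin k → ℕ) → ℕ
lcmFin {zero}  f = 1
lcmFin {suc k} f = lcm (f zero) (lcmFin (λ i → f (suc i)))

module Submission where

-- The hypotheses say that S is gcd-closed and that its divisibility order is the lattice
-- with bottom x₁, the n − 2 pairwise incomparable atoms x₂, …, xₙ₋₁, and top xₙ.
-- Since lcm(a, b) = a b / gcd(a, b), the LCM matrix is D G D with D = diag(xᵢ) and G the meet
-- matrix of f = 1/x.  By Möbius inversion along the lattice G = ζ Λ ζᵀ, where ζ is the
-- (unimodular) zeta matrix of the order and Λ = diag(Ψ) with Ψ(s) = Σ_{t ≤ s} μ(t, s) f(t).
-- So [S] is invertible as soon as no Ψ(s) vanishes.  Ψ(x₁) = 1/x₁, and Ψ(xᵢ) = 1/xᵢ − 1/x₁ ≠ 0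
-- by distinctness.  Clearing denominators, xₙ Ψ(xₙ) = 1 + (n − 3) A − Σ Bᵢ with A = xₙ/x₁ and
-- Bᵢ = xₙ/xᵢ.  Each xᵢ is a proper multiple of x₁, so 2 Bᵢ ≤ A and the value is positive for
-- n ≥ 4; for n = 3 it is 1 − B₂ ≠ 0 because x₂ ≠ x₃.

open import Defs
open import Data.Nat as ℕ using (ℕ; zero; suc; _≤_; _<_; s≤s; z≤n)
open import Data.Nat.GCD using (gcd; gcd[m,n]∣m; gcd[m,n]∣n; gcd-greatest; gcd-comm)
open import Data.Nat.Divisibility using (_∣_; ∣-antisym; ∣-refl; ∣-trans)
open import Data.Fin as Fin using (Fin; zero; suc; inject₁; fromℕ)
open import Function.Definitions using (Injective)
open import Relation.Binary.PropositionalEquality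
  using (_≡_; _≢_; refl; sym; trans; cong; cong₂; subst; module ≡-Reasoning)

open import Level using (0ℓ)
open import Algebra.Bundles using (CommutativeRing)
import Algebra.Properties.Semiring.Sum
open import Data.Empty using (⊥-elim)
open import Data.Fin.Properties using (0≢1+n; suc-injective; fromℕ≢inject₁)
import Data.Fin.Relation.Unary.Top as Top
open Top using (‵fromℕ; ‵inj₁; ‵inject₁)
import Data.Integer as ℤ
import Data.Integer.Properties as ℤP
open import Data.Maybe using (Maybe; just; nothing)
open import Data.Nat.Coprimality using (1-coprimeTo) renaming (sym to coprime-sym)
open import Data.Nat.LCM using (lcm; gcd*lcm; m∣lcm[m,n]; n∣lcm[m,n])
import Data.Nat.Properties as ℕP
open import Data.Nat.Properties using (module ≤-Reasoning)
import Data.Nat.Tactic.RingSolver as ℕ-Solver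
open import Data.Rational using (ℚ; 0ℚ; 1ℚ; _+_; _*_; -_; _-_; 1/_; ≢-nonZero; mkℚ; ↥_)
import Data.Rational as ℚ
open import Data.Rational.Properties
  using (_≟_; 1≢0; +-0-group; +-*-commutativeRing; normalize-coprime; +-identityˡ; +-identityʳ;
         *-zeroˡ; *-zeroʳ; *-identityˡ; *-identityʳ; *-comm; *-assoc; *-inverseˡ; *-inverseʳ)
open import Algebra.Properties.Group +-0-group using (x∙y⁻¹≈ε⇒x≈y)
open import Relation.Nullary using (yes; no)
open import Tactic.RingSolver using (solve-∀)
open import Tactic.RingSolver.Core.AlmostCommutativeRing using (AlmostCommutativeRing; fromCommutativeRing)

open Algebra.Properties.Semiring.Sum (CommutativeRing.semiring +-*-commutativeRing)
  using (sum; sum-cong-≗; ∑-comm; ∑-distrib-+; *-distribˡ-sum; *-distribʳ-sum; sum-init-last)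
module ℕΣ = Algebra.Properties.Semiring.Sum ℕP.+-*-semiring

ℚ-ring : AlmostCommutativeRing 0ℓ 0ℓ
ℚ-ring = fromCommutativeRing +-*-commutativeRing is-zero
  where
  is-zero : (x : ℚ) → Maybe (0ℚ ≡ x)
  is-zero x with 0ℚ ≟ x
  ... | yes 0≡x = just 0≡x
  ... | no  _   = nothing

toℚ≡mkℚ : ∀ n → toℚ n ≡ mkℚ (ℤ.+ n) 0 (coprime-sym (1-coprimeTo n))
toℚ≡mkℚ n = normalize-coprime (coprime-sym (1-coprimeTo n))

toℚ-+ : ∀ a b → toℚ (a ℕ.+ b) ≡ toℚ a + toℚ b
toℚ-+ a b = sym (begin
  toℚ a + toℚ b                                    ≡⟨ cong₂ _+_ (toℚ≡mkℚ a) (toℚ≡mkℚ b) ⟩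
  (ℤ.+ a ℤ.* ℤ.+ 1 ℤ.+ ℤ.+ b ℤ.* ℤ.+ 1) ℚ./ 1
    ≡⟨ cong (ℚ._/ 1) (cong₂ ℤ._+_ (ℤP.*-identityʳ (ℤ.+ a)) (ℤP.*-identityʳ (ℤ.+ b))) ⟩
  toℚ (a ℕ.+ b)                                    ∎)
  where open ≡-Reasoning

toℚ-* : ∀ a b → toℚ (a ℕ.* b) ≡ toℚ a * toℚ b
toℚ-* a b = sym (begin
  toℚ a * toℚ b                ≡⟨ cong₂ _*_ (toℚ≡mkℚ a) (toℚ≡mkℚ b) ⟩
  (ℤ.+ a ℤ.* ℤ.+ b) ℚ./ 1     ≡⟨ cong (ℚ._/ 1) (ℤP.pos-* a b) ⟨
  toℚ (a ℕ.* b)                ∎)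
  where open ≡-Reasoning

toℚ-injective : ∀ {a b} → toℚ a ≡ toℚ b → a ≡ b
toℚ-injective {a} {b} eq = ℤP.+-injective (cong ↥_ (trans (sym (toℚ≡mkℚ a)) (trans eq (toℚ≡mkℚ b))))

toℚ-sum : ∀ {m} (f : Fin m → ℕ) → toℚ (ℕΣ.sum f) ≡ sum (λ i → toℚ (f i))
toℚ-sum {zero}  f = refl
toℚ-sum {suc m} f = trans (toℚ-+ (f zero) (ℕΣ.sum (λ i → f (suc i))))
  (cong (toℚ (f zero) +_) (toℚ-sum (λ i → f (suc i))))

gcd-of-divisor : ∀ {a b} → a ∣ b → gcd a b ≡ a
gcd-of-divisor {a} {b} a∣b = ∣-antisym (gcd[m,n]∣m a b) (gcd-greatest ∣-refl a∣b)

∣lcmFin : ∀ {k} (f : Fin k → ℕ) i → f i ∣ lcmFin f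
∣lcmFin f zero    = m∣lcm[m,n] (f zero) (lcmFin (λ i → f (suc i)))
∣lcmFin f (suc i) = ∣-trans (∣lcmFin (λ i → f (suc i)) i) (n∣lcm[m,n] (f zero) (lcmFin (λ i → f (suc i))))

2*quotient≤quotient : ∀ {a b t A B c} → 0 < b → b ≢ a → b ≡ c ℕ.* a → t ≡ B ℕ.* b → t ≡ A ℕ.* a
  → 2 ℕ.* B ≤ A
2*quotient≤quotient {zero} {c = c} 0<b _ b≡ca _ _ = ⊥-elim (ℕP.<-irrefl (sym (trans b≡ca (ℕP.*-zeroʳ c))) 0<b)
2*quotient≤quotient {suc a} {c = zero} 0<b _ b≡ca _ _ = ⊥-elim (ℕP.<-irrefl (sym b≡ca) 0<b)
2*quotient≤quotient {suc a} {c = suc zero} _ b≢a b≡ca _ _ = ⊥-elim (b≢a (trans b≡ca (ℕP.*-identityˡ (suc a))))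
2*quotient≤quotient {suc a} {b} {t} {A} {B} {suc (suc c)} _ _ b≡ca t≡Bb t≡Aa = begin
  2 ℕ.* B              ≤⟨ ℕP.*-monoˡ-≤ B {2} {suc (suc c)} (s≤s (s≤s z≤n)) ⟩
  suc (suc c) ℕ.* B    ≡⟨ ℕP.*-comm (suc (suc c)) B ⟩
  B ℕ.* suc (suc c)    ≡⟨ ℕP.*-cancelʳ-≡ (B ℕ.* suc (suc c)) A (suc a) Bc*a≡A*a ⟩
  A                    ∎
  where
  open ≤-Reasoning
  Bc*a≡A*a : B ℕ.* suc (suc c) ℕ.* suc a ≡ A ℕ.* suc a
  Bc*a≡A*a = trans (ℕP.*-assoc B (suc (suc c)) (suc a)) (trans (cong (B ℕ.*_) (sym b≡ca)) (trans (sym t≡Bb) t≡Aa))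

sumℕ-const : ∀ m A → ℕΣ.sum {m} (λ _ → A) ≡ m ℕ.* A
sumℕ-const zero    A = refl
sumℕ-const (suc m) A = cong (A ℕ.+_) (sumℕ-const m A)

sumℕ-mono-≤ : ∀ {m} {f g : Fin m → ℕ} → (∀ i → f i ≤ g i) → ℕΣ.sum f ≤ ℕΣ.sum g
sumℕ-mono-≤ {zero}  f≤g = z≤n
sumℕ-mono-≤ {suc m} f≤g = ℕP.+-mono-≤ (f≤g zero) (sumℕ-mono-≤ (λ i → f≤g (suc i)))

A+ΣB≢1+m*A : ∀ {m} A (B : Fin (suc m) → ℕ) → (∀ i → 2 ℕ.* B i ≤ A) → (∀ i → B i ≢ 1)
  → A ℕ.+ ℕΣ.sum B ≢ 1 ℕ.+ suc m ℕ.* A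
A+ΣB≢1+m*A {zero} A B _ B≢1 eq = B≢1 zero (ℕP.+-cancelˡ-≡ A (B zero) 1 (begin
  A ℕ.+ B zero          ≡⟨ cong (A ℕ.+_) (ℕP.+-identityʳ (B zero)) ⟨
  A ℕ.+ ℕΣ.sum B        ≡⟨ eq ⟩
  1 ℕ.+ (A ℕ.+ 0)       ≡⟨ cong (1 ℕ.+_) (ℕP.+-identityʳ A) ⟩
  1 ℕ.+ A               ≡⟨ ℕP.+-comm 1 A ⟩
  A ℕ.+ 1               ∎))
  where open ≡-Reasoning
A+ΣB≢1+m*A {suc m} A B 2B≤A _ eq = ℕP.<-irrefl refl (begin-strict
  2 ℕ.* (1 ℕ.+ M ℕ.* A)           ≡⟨ cong (2 ℕ.*_) eq ⟨
  2 ℕ.* (A ℕ.+ ℕΣ.sum B)          ≡⟨ ℕP.*-distribˡ-+ 2 A (ℕΣ.sum B) ⟩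
  2 ℕ.* A ℕ.+ 2 ℕ.* ℕΣ.sum B      ≤⟨ ℕP.+-monoʳ-≤ (2 ℕ.* A) 2ΣB≤M*A ⟩
  2 ℕ.* A ℕ.+ M ℕ.* A             <⟨ ℕP.m<n+m (2 ℕ.* A ℕ.+ M ℕ.* A) {2} (s≤s z≤n) ⟩
  2 ℕ.+ (2 ℕ.* A ℕ.+ M ℕ.* A)
    ≤⟨ ℕP.+-monoʳ-≤ 2 (ℕP.+-monoˡ-≤ (M ℕ.* A) (ℕP.*-monoˡ-≤ A {2} {M} (s≤s (s≤s z≤n)))) ⟩
  2 ℕ.+ (M ℕ.* A ℕ.+ M ℕ.* A)     ≡⟨ 2+[x+x]≡2*[1+x] (M ℕ.* A) ⟩
  2 ℕ.* (1 ℕ.+ M ℕ.* A)           ∎)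
  where
  open ≤-Reasoning
  M : ℕ
  M = suc (suc m)
  2ΣB≤M*A : 2 ℕ.* ℕΣ.sum B ≤ M ℕ.* A
  2ΣB≤M*A = begin
    2 ℕ.* ℕΣ.sum B              ≡⟨ ℕΣ.*-distribˡ-sum 2 B ⟩
    ℕΣ.sum (λ i → 2 ℕ.* B i)    ≤⟨ sumℕ-mono-≤ 2B≤A ⟩
    ℕΣ.sum {M} (λ _ → A)        ≡⟨ sumℕ-const M A ⟩
    M ℕ.* A                     ∎
  2+[x+x]≡2*[1+x] : ∀ x → 2 ℕ.+ (x ℕ.+ x) ≡ 2 ℕ.* (1 ℕ.+ x)
  2+[x+x]≡2*[1+x] = ℕ-Solver.solve-∀

sumFin≡sum : ∀ {n} (f : Fin n → ℚ) → sumFin f ≡ sum f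
sumFin≡sum {zero}  f = refl
sumFin≡sum {suc n} f = cong (f zero +_) (sumFin≡sum (λ i → f (suc i)))

sum-scale : ∀ {n} (c : ℚ) (f : Fin n → ℚ) → sum (λ i → c * f i) ≡ c * sum f
sum-scale c f = sym (*-distribˡ-sum c f)

sum-zero : ∀ {n} (f : Fin n → ℚ) → sum (λ i → 0ℚ * f i) ≡ 0ℚ
sum-zero f = trans (sum-scale 0ℚ f) (*-zeroˡ (sum f))

sum-const : ∀ n (c : ℚ) → sum {n} (λ _ → c) ≡ toℚ n * c
sum-const zero    c = sym (*-zeroˡ c)
sum-const (suc n) c = begin
  c + sum {n} (λ _ → c)   ≡⟨ cong (c +_) (sum-const n c) ⟩
  c + toℚ n * c           ≡⟨ c+n*c≡[1+n]*c c (toℚ n) ⟩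
  (1ℚ + toℚ n) * c        ≡⟨ cong (_* c) (toℚ-+ 1 n) ⟨
  toℚ (suc n) * c         ∎
  where
  open ≡-Reasoning
  c+n*c≡[1+n]*c : ∀ c n → c + n * c ≡ (1ℚ + n) * c
  c+n*c≡[1+n]*c = solve-∀ ℚ-ring

δ-refl : ∀ {n} (i : Fin n) → δ i i ≡ 1ℚ
δ-refl zero    = refl
δ-refl (suc i) = δ-refl i

δ-off : ∀ {n} {i j : Fin n} → i ≢ j → δ i j ≡ 0ℚ
δ-off {i = zero}  {zero}  i≢j = ⊥-elim (i≢j refl)
δ-off {i = zero}  {suc j} _   = refl
δ-off {i = suc i} {zero}  _   = refl
δ-off {i = suc i} {suc j} i≢j = δ-off (λ i≡j → i≢j (cong suc i≡j))

δ-sym : ∀ {n} (i j : Fin n) → δ i j ≡ δ j i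
δ-sym zero    zero    = refl
δ-sym zero    (suc j) = refl
δ-sym (suc i) zero    = refl
δ-sym (suc i) (suc j) = δ-sym i j

sum-δˡ : ∀ {n} (i : Fin n) (f : Fin n → ℚ) → sum (λ j → δ i j * f j) ≡ f i
sum-δˡ zero    f = begin
  1ℚ * f zero + sum (λ j → 0ℚ * f (suc j))  ≡⟨ cong (1ℚ * f zero +_) (sum-zero (λ j → f (suc j))) ⟩
  1ℚ * f zero + 0ℚ                          ≡⟨ +-identityʳ (1ℚ * f zero) ⟩
  1ℚ * f zero                               ≡⟨ *-identityˡ (f zero) ⟩
  f zero                                    ∎
  where open ≡-Reasoning
sum-δˡ (suc i) f = begin
  0ℚ * f zero + sum (λ j → δ i j * f (suc j))  ≡⟨ cong₂ _+_ (*-zeroˡ (f zero)) (sum-δˡ i (λ j → f (suc j))) ⟩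
  0ℚ + f (suc i)                               ≡⟨ +-identityˡ (f (suc i)) ⟩
  f (suc i)                                    ∎
  where open ≡-Reasoning

sum-δʳ : ∀ {n} (i : Fin n) (f : Fin n → ℚ) → sum (λ j → f j * δ j i) ≡ f i
sum-δʳ i f = trans (sum-cong-≗ (λ j → trans (*-comm (f j) (δ j i)) (cong (_* f j) (δ-sym j i)))) (sum-δˡ i f)

infix 4 _≐_
_≐_ : ∀ {n} → Matrix n → Matrix n → Set
A ≐ B = ∀ i j → A i j ≡ B i j

infix 30 _ᵀ
_ᵀ : ∀ {n} → Matrix n → Matrix n
(A ᵀ) i j = A j i

diag : ∀ {n} → (Fin n → ℚ) → Matrix n
diag d i j = δ i j * d j

⊗-entry : ∀ {n} (A B : Matrix n) i j → (A ⊗ B) i j ≡ sum (λ k → A i k * B k j)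
⊗-entry A B i j = sumFin≡sum (λ k → A i k * B k j)

⊗-congˡ : ∀ {n} {A A′ : Matrix n} (B : Matrix n) → A ≐ A′ → A ⊗ B ≐ A′ ⊗ B
⊗-congˡ {A = A} {A′} B A≐A′ i j = trans (⊗-entry A B i j)
  (trans (sum-cong-≗ (λ k → cong (_* B k j) (A≐A′ i k))) (sym (⊗-entry A′ B i j)))

⊗-congʳ : ∀ {n} {B B′ : Matrix n} (A : Matrix n) → B ≐ B′ → A ⊗ B ≐ A ⊗ B′
⊗-congʳ {B = B} {B′} A B≐B′ i j = trans (⊗-entry A B i j)
  (trans (sum-cong-≗ (λ k → cong (A i k *_) (B≐B′ k j))) (sym (⊗-entry A B′ i j)))

⊗-assoc : ∀ {n} (A B C : Matrix n) → (A ⊗ B) ⊗ C ≐ A ⊗ (B ⊗ C)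
⊗-assoc A B C i j = begin
  ((A ⊗ B) ⊗ C) i j                                 ≡⟨ ⊗-entry (A ⊗ B) C i j ⟩
  sum (λ k → (A ⊗ B) i k * C k j)                   ≡⟨ sum-cong-≗ (λ k → cong (_* C k j) (⊗-entry A B i k)) ⟩
  sum (λ k → sum (λ l → A i l * B l k) * C k j)
    ≡⟨ sum-cong-≗ (λ k → *-distribʳ-sum (C k j) (λ l → A i l * B l k)) ⟩
  sum (λ k → sum (λ l → A i l * B l k * C k j))
    ≡⟨ ∑-comm (λ k l → A i l * B l k * C k j) ⟩
  sum (λ l → sum (λ k → A i l * B l k * C k j))
    ≡⟨ sum-cong-≗ (λ l → sum-cong-≗ (λ k → *-assoc (A i l) (B l k) (C k j))) ⟩
  sum (λ l → sum (λ k → A i l * (B l k * C k j)))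
    ≡⟨ sum-cong-≗ (λ l → sum-scale (A i l) (λ k → B l k * C k j)) ⟩
  sum (λ l → A i l * sum (λ k → B l k * C k j))     ≡⟨ sum-cong-≗ (λ l → cong (A i l *_) (⊗-entry B C l j)) ⟨
  sum (λ l → A i l * (B ⊗ C) l j)                   ≡⟨ ⊗-entry A (B ⊗ C) i j ⟨
  (A ⊗ (B ⊗ C)) i j                                 ∎
  where open ≡-Reasoning

⊗-identityˡ : ∀ {n} (A : Matrix n) → identity ⊗ A ≐ A
⊗-identityˡ A i j = trans (⊗-entry identity A i j) (sum-δˡ i (λ k → A k j))

diag-⊗ : ∀ {n} (d : Fin n → ℚ) (A : Matrix n) i j → (diag d ⊗ A) i j ≡ d i * A i j
diag-⊗ d A i j = trans (⊗-entry (diag d) A i j)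
  (trans (sum-cong-≗ (λ k → *-assoc (δ i k) (d k) (A k j))) (sum-δˡ i (λ k → d k * A k j)))

⊗-diag : ∀ {n} (A : Matrix n) (d : Fin n → ℚ) i j → (A ⊗ diag d) i j ≡ A i j * d j
⊗-diag A d i j = begin
  (A ⊗ diag d) i j                    ≡⟨ ⊗-entry A (diag d) i j ⟩
  sum (λ k → A i k * (δ k j * d j))   ≡⟨ sum-cong-≗ (λ k → *-assoc (A i k) (δ k j) (d j)) ⟨
  sum (λ k → A i k * δ k j * d j)     ≡⟨ *-distribʳ-sum (d j) (λ k → A i k * δ k j) ⟨
  sum (λ k → A i k * δ k j) * d j     ≡⟨ cong (_* d j) (sum-δʳ j (A i)) ⟩
  A i j * d j                         ∎
  where open ≡-Reasoning

⊗-transpose : ∀ {n} (A B : Matrix n) → (A ⊗ B) ᵀ ≐ B ᵀ ⊗ A ᵀ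
⊗-transpose A B i j = trans (⊗-entry A B j i)
  (trans (sum-cong-≗ (λ k → *-comm (A j k) (B k i))) (sym (⊗-entry (B ᵀ) (A ᵀ) i j)))

identityᵀ : ∀ {n} → identity {n} ᵀ ≐ identity
identityᵀ i j = δ-sym j i

open Invertible

Invertible-cong : ∀ {n} {A B : Matrix n} → A ≐ B → Invertible A → Invertible B
Invertible-cong A≐B A⁻¹ = record
  { inverse = inverse A⁻¹
  ; left    = λ i j → trans (⊗-congʳ (inverse A⁻¹) (λ k l → sym (A≐B k l)) i j) (left A⁻¹ i j)
  ; right   = λ i j → trans (⊗-congˡ (inverse A⁻¹) (λ k l → sym (A≐B k l)) i j) (right A⁻¹ i j)
  }

⊗-inverse : ∀ {n} (A A′ B B′ : Matrix n) → A ⊗ A′ ≐ identity → B ⊗ B′ ≐ identity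
  → (A ⊗ B) ⊗ (B′ ⊗ A′) ≐ identity
⊗-inverse A A′ B B′ AA′≐I BB′≐I i j = begin
  ((A ⊗ B) ⊗ (B′ ⊗ A′)) i j   ≡⟨ ⊗-assoc A B (B′ ⊗ A′) i j ⟩
  (A ⊗ (B ⊗ (B′ ⊗ A′))) i j   ≡⟨ ⊗-congʳ A (λ k l → sym (⊗-assoc B B′ A′ k l)) i j ⟩
  (A ⊗ ((B ⊗ B′) ⊗ A′)) i j   ≡⟨ ⊗-congʳ A (⊗-congˡ A′ BB′≐I) i j ⟩
  (A ⊗ (identity ⊗ A′)) i j   ≡⟨ ⊗-congʳ A (⊗-identityˡ A′) i j ⟩
  (A ⊗ A′) i j                ≡⟨ AA′≐I i j ⟩
  identity i j                ∎
  where open ≡-Reasoning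

Invertible-⊗ : ∀ {n} {A B : Matrix n} → Invertible A → Invertible B → Invertible (A ⊗ B)
Invertible-⊗ {A = A} {B} A⁻¹ B⁻¹ = record
  { inverse = inverse B⁻¹ ⊗ inverse A⁻¹
  ; left    = ⊗-inverse (inverse B⁻¹) B (inverse A⁻¹) A (left B⁻¹) (left A⁻¹)
  ; right   = ⊗-inverse A (inverse A⁻¹) B (inverse B⁻¹) (right A⁻¹) (right B⁻¹)
  }

Invertible-ᵀ : ∀ {n} {A : Matrix n} → Invertible A → Invertible (A ᵀ)
Invertible-ᵀ {A = A} A⁻¹ = record
  { inverse = inverse A⁻¹ ᵀ
  ; left    = λ i j → trans (sym (⊗-transpose A (inverse A⁻¹) i j)) (trans (right A⁻¹ j i) (identityᵀ i j))
  ; right   = λ i j → trans (sym (⊗-transpose (inverse A⁻¹) A i j)) (trans (left A⁻¹ j i) (identityᵀ i j))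
  }

Invertible-diag : ∀ {n} (d : Fin n → ℚ) → (∀ i → d i ≢ 0ℚ) → Invertible (diag d)
Invertible-diag {n} d d≢0 = record
  { inverse = diag d⁻¹
  ; left    = λ i j → trans (⊗-diag (diag d⁻¹) d i j) (trans (*-assoc (δ i j) (d⁻¹ j) (d j))
                        (trans (cong (δ i j *_) (d⁻¹*d≡1 j)) (*-identityʳ (δ i j))))
  ; right   = λ i j → trans (⊗-diag (diag d) d⁻¹ i j) (trans (*-assoc (δ i j) (d j) (d⁻¹ j))
                        (trans (cong (δ i j *_) (d*d⁻¹≡1 j)) (*-identityʳ (δ i j))))
  }
  where
  d⁻¹ : Fin n → ℚ
  d⁻¹ i = (1/ d i) {{≢-nonZero (d≢0 i)}}
  d⁻¹*d≡1 : ∀ i → d⁻¹ i * d i ≡ 1ℚ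
  d⁻¹*d≡1 i = *-inverseˡ (d i) {{≢-nonZero (d≢0 i)}}
  d*d⁻¹≡1 : ∀ i → d i * d⁻¹ i ≡ 1ℚ
  d*d⁻¹≡1 i = *-inverseʳ (d i) {{≢-nonZero (d≢0 i)}}

Invertible-congruence : ∀ {n} {L : Matrix n} (d : Fin n → ℚ) → Invertible L → (∀ i → d i ≢ 0ℚ)
  → Invertible ((L ⊗ diag d) ⊗ L ᵀ)
Invertible-congruence d L⁻¹ d≢0 = Invertible-⊗ (Invertible-⊗ L⁻¹ (Invertible-diag d d≢0)) (Invertible-ᵀ L⁻¹)

congruence-entry : ∀ {n} (X d : Fin n → ℚ) (Z : Matrix n) a b
  → (((diag X ⊗ Z) ⊗ diag d) ⊗ (diag X ⊗ Z) ᵀ) a b ≡ X a * X b * sum (λ c → Z a c * (Z b c * d c))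
congruence-entry {n} X d Z a b = begin
  (((diag X ⊗ Z) ⊗ diag d) ⊗ L ᵀ) a b                ≡⟨ ⊗-entry ((diag X ⊗ Z) ⊗ diag d) (L ᵀ) a b ⟩
  sum (λ c → ((diag X ⊗ Z) ⊗ diag d) a c * L b c)
    ≡⟨ sum-cong-≗ (λ c → cong₂ _*_ (trans (⊗-diag L d a c) (cong (_* d c) (diag-⊗ X Z a c))) (diag-⊗ X Z b c)) ⟩
  sum (λ c → X a * Z a c * d c * (X b * Z b c))
    ≡⟨ sum-cong-≗ (λ c → regroup (X a) (X b) (Z a c) (Z b c) (d c)) ⟩
  sum (λ c → X a * X b * (Z a c * (Z b c * d c)))     ≡⟨ sum-scale (X a * X b) (λ c → Z a c * (Z b c * d c)) ⟩
  X a * X b * sum (λ c → Z a c * (Z b c * d c))       ∎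
  where
  open ≡-Reasoning
  L : Matrix n
  L = diag X ⊗ Z
  regroup : ∀ xa xb za zb e → xa * za * e * (xb * zb) ≡ xa * xb * (za * (zb * e))
  regroup = solve-∀ ℚ-ring

-- The diamond lattice

data Diamond (m : ℕ) : Set where
  bot  : Diamond m
  atom : Fin m → Diamond m
  top  : Diamond m

-- Fin (m + 2) lists the diamond as bottom, the m atoms, top.
⌜_⌝ : ∀ {m} → Diamond m → Fin (suc (suc m))
⌜ bot ⌝    = zero
⌜ atom i ⌝ = suc (inject₁ i)
⌜ top ⌝    = suc (fromℕ _)

belowTop : ∀ {m} {j : Fin (suc m)} → Top.View j → Diamond m
belowTop ‵fromℕ       = top
belowTop (‵inject₁ i) = atom i

pos : ∀ {m} → Fin (suc (suc m)) → Diamond m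
pos zero    = bot
pos (suc j) = belowTop (Top.view j)

⌜pos⌝ : ∀ {m} (a : Fin (suc (suc m))) → ⌜ pos a ⌝ ≡ a
⌜pos⌝ zero    = refl
⌜pos⌝ (suc j) = trans (⌜belowTop⌝ (Top.view j)) (cong suc (Top.view-complete (Top.view j)))
  where
  ⌜belowTop⌝ : ∀ {m} {j : Fin (suc m)} (v : Top.View j) → ⌜ belowTop v ⌝ ≡ suc Top.⟦ v ⟧
  ⌜belowTop⌝ ‵fromℕ    = refl
  ⌜belowTop⌝ (‵inj₁ _) = refl

pos⌜⌝ : ∀ {m} (p : Diamond m) → pos ⌜ p ⌝ ≡ p
pos⌜⌝ bot      = refl
pos⌜⌝ (atom i) = cong belowTop (Top.view-inject₁ i)
pos⌜⌝ top      = cong belowTop (Top.view-fromℕ _)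

pos-injective : ∀ {m} {a b : Fin (suc (suc m))} → pos a ≡ pos b → a ≡ b
pos-injective {a = a} {b} pa≡pb = trans (sym (⌜pos⌝ a)) (trans (cong ⌜_⌝ pa≡pb) (⌜pos⌝ b))

Σᴰ : ∀ {m} → (Diamond m → ℚ) → ℚ
Σᴰ g = g bot + (sum (λ i → g (atom i)) + g top)

sum-pos : ∀ {m} (g : Diamond m → ℚ) → sum (λ a → g (pos a)) ≡ Σᴰ g
sum-pos {m} g = cong (g bot +_) (begin
  sum h                                      ≡⟨ sum-init-last h ⟩
  sum (λ i → h (inject₁ i)) + h (fromℕ m)
    ≡⟨ cong₂ _+_ (sum-cong-≗ (λ i → cong g (pos⌜⌝ (atom i)))) (cong g (pos⌜⌝ top)) ⟩
  sum (λ i → g (atom i)) + g top             ∎)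
  where
  open ≡-Reasoning
  h : Fin (suc m) → ℚ
  h j = g (pos (suc j))

Matrixᴰ : ℕ → Set
Matrixᴰ m = Diamond m → Diamond m → ℚ

infixl 20 _⊛_
_⊛_ : ∀ {m} → Matrixᴰ m → Matrixᴰ m → Matrixᴰ m
(A ⊛ B) p r = Σᴰ (λ s → A p s * B s r)

𝟙ᴰ : ∀ {m} → Matrixᴰ m
𝟙ᴰ bot      bot      = 1ℚ
𝟙ᴰ (atom i) (atom j) = δ i j
𝟙ᴰ top      top      = 1ℚ
𝟙ᴰ _        _        = 0ℚ

𝟙ᴰ-refl : ∀ {m} (p : Diamond m) → 𝟙ᴰ p p ≡ 1ℚ
𝟙ᴰ-refl bot      = refl
𝟙ᴰ-refl (atom i) = δ-refl i
𝟙ᴰ-refl top      = refl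

𝟙ᴰ-off : ∀ {m} {p r : Diamond m} → p ≢ r → 𝟙ᴰ p r ≡ 0ℚ
𝟙ᴰ-off {p = bot}    {bot}    p≢r = ⊥-elim (p≢r refl)
𝟙ᴰ-off {p = bot}    {atom j} _   = refl
𝟙ᴰ-off {p = bot}    {top}    _   = refl
𝟙ᴰ-off {p = atom i} {bot}    _   = refl
𝟙ᴰ-off {p = atom i} {atom j} p≢r = δ-off (λ i≡j → p≢r (cong atom i≡j))
𝟙ᴰ-off {p = atom i} {top}    _   = refl
𝟙ᴰ-off {p = top}    {bot}    _   = refl
𝟙ᴰ-off {p = top}    {atom j} _   = refl
𝟙ᴰ-off {p = top}    {top}    p≢r = ⊥-elim (p≢r refl)

⟦_⟧ : ∀ {m} → Matrixᴰ m → Matrix (suc (suc m))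
⟦ A ⟧ a b = A (pos a) (pos b)

identity≐⟦𝟙ᴰ⟧ : ∀ {m} → identity ≐ ⟦ 𝟙ᴰ {m} ⟧
identity≐⟦𝟙ᴰ⟧ a b with a Fin.≟ b
... | yes refl = trans (δ-refl a) (sym (𝟙ᴰ-refl (pos a)))
... | no  a≢b  = trans (δ-off a≢b) (sym (𝟙ᴰ-off (λ pa≡pb → a≢b (pos-injective pa≡pb))))

⟦⟧-⊗ : ∀ {m} (A B : Matrixᴰ m) → ⟦ A ⟧ ⊗ ⟦ B ⟧ ≐ ⟦ A ⊛ B ⟧
⟦⟧-⊗ A B a b = trans (⊗-entry ⟦ A ⟧ ⟦ B ⟧ a b) (sum-pos (λ s → A (pos a) s * B s (pos b)))

Invertible-⟦⟧ : ∀ {m} (A B : Matrixᴰ m)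
  → (∀ p r → (A ⊛ B) p r ≡ 𝟙ᴰ p r) → (∀ p r → (B ⊛ A) p r ≡ 𝟙ᴰ p r) → Invertible ⟦ A ⟧
Invertible-⟦⟧ A B AB≡𝟙 BA≡𝟙 = record
  { inverse = ⟦ B ⟧
  ; left    = λ a b → trans (⟦⟧-⊗ B A a b) (trans (BA≡𝟙 (pos a) (pos b)) (sym (identity≐⟦𝟙ᴰ⟧ a b)))
  ; right   = λ a b → trans (⟦⟧-⊗ A B a b) (trans (AB≡𝟙 (pos a) (pos b)) (sym (identity≐⟦𝟙ᴰ⟧ a b)))
  }

-- ζ p s = 1 exactly when s ≤ p, and μ is the Möbius function of the diamond.
ζ : ∀ {m} → Matrixᴰ m
ζ bot      bot      = 1ℚ
ζ bot      _        = 0ℚ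
ζ (atom i) bot      = 1ℚ
ζ (atom i) (atom j) = δ i j
ζ (atom i) top      = 0ℚ
ζ top      _        = 1ℚ

μ : ∀ {m} → Matrixᴰ m
μ bot      bot      = 1ℚ
μ bot      _        = 0ℚ
μ (atom i) bot      = - 1ℚ
μ (atom i) (atom j) = δ i j
μ (atom i) top      = 0ℚ
μ {m} top  bot      = toℚ m - 1ℚ
μ top      (atom j) = - 1ℚ
μ top      top      = 1ℚ

ζ⊛μ≡𝟙ᴰ : ∀ {m} (p r : Diamond m) → (ζ ⊛ μ) p r ≡ 𝟙ᴰ p r
ζ⊛μ≡𝟙ᴰ bot r = trans (cong (λ t → 1ℚ * μ bot r + (t + 0ℚ * μ top r)) (sum-zero (λ i → μ (atom i) r)))
  (trans (1*x+[0+0*y]≡x (μ bot r) (μ top r)) (μ-bot r))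
  where
  1*x+[0+0*y]≡x : ∀ x y → 1ℚ * x + (0ℚ + 0ℚ * y) ≡ x
  1*x+[0+0*y]≡x = solve-∀ ℚ-ring
  μ-bot : ∀ r → μ bot r ≡ 𝟙ᴰ bot r
  μ-bot bot      = refl
  μ-bot (atom j) = refl
  μ-bot top      = refl
ζ⊛μ≡𝟙ᴰ (atom i) r = trans (cong (λ t → 1ℚ * μ bot r + (t + 0ℚ * μ top r)) (sum-δˡ i (λ k → μ (atom k) r)))
  (trans (1*x+[y+0*z]≡x+y (μ bot r) (μ (atom i) r) (μ top r)) (μ-bot+μ-atom r))
  where
  1*x+[y+0*z]≡x+y : ∀ x y z → 1ℚ * x + (y + 0ℚ * z) ≡ x + y
  1*x+[y+0*z]≡x+y = solve-∀ ℚ-ring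
  μ-bot+μ-atom : ∀ r → μ bot r + μ (atom i) r ≡ 𝟙ᴰ (atom i) r
  μ-bot+μ-atom bot      = refl
  μ-bot+μ-atom (atom j) = +-identityˡ (δ i j)
  μ-bot+μ-atom top      = refl
ζ⊛μ≡𝟙ᴰ {m} top bot = trans (cong (λ t → 1ℚ * 1ℚ + (t + 1ℚ * (toℚ m - 1ℚ))) (sum-const m (1ℚ * - 1ℚ)))
  (1+[M*-1+[M-1]]≡0 (toℚ m))
  where
  1+[M*-1+[M-1]]≡0 : ∀ M → 1ℚ * 1ℚ + (M * (1ℚ * - 1ℚ) + 1ℚ * (M - 1ℚ)) ≡ 0ℚ
  1+[M*-1+[M-1]]≡0 = solve-∀ ℚ-ring
ζ⊛μ≡𝟙ᴰ top (atom j) = cong (λ t → 1ℚ * 0ℚ + (t + 1ℚ * - 1ℚ)) (sum-δʳ j (λ _ → 1ℚ))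
ζ⊛μ≡𝟙ᴰ {m} top top = trans (cong (λ t → 1ℚ * 0ℚ + (t + 1ℚ * 1ℚ)) (sum-const m (1ℚ * 0ℚ)))
  (0+[M*0+1]≡1 (toℚ m))
  where
  0+[M*0+1]≡1 : ∀ M → 1ℚ * 0ℚ + (M * (1ℚ * 0ℚ) + 1ℚ * 1ℚ) ≡ 1ℚ
  0+[M*0+1]≡1 = solve-∀ ℚ-ring

μ⊛ζ≡𝟙ᴰ : ∀ {m} (p r : Diamond m) → (μ ⊛ ζ) p r ≡ 𝟙ᴰ p r
μ⊛ζ≡𝟙ᴰ bot r = trans (cong (λ t → 1ℚ * ζ bot r + (t + 0ℚ * ζ top r)) (sum-zero (λ i → ζ (atom i) r)))
  (trans (1*x+[0+0*y]≡x (ζ bot r) (ζ top r)) (ζ-bot r))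
  where
  1*x+[0+0*y]≡x : ∀ x y → 1ℚ * x + (0ℚ + 0ℚ * y) ≡ x
  1*x+[0+0*y]≡x = solve-∀ ℚ-ring
  ζ-bot : ∀ r → ζ bot r ≡ 𝟙ᴰ bot r
  ζ-bot bot      = refl
  ζ-bot (atom j) = refl
  ζ-bot top      = refl
μ⊛ζ≡𝟙ᴰ (atom i) r = trans (cong (λ t → - 1ℚ * ζ bot r + (t + 0ℚ * ζ top r)) (sum-δˡ i (λ k → ζ (atom k) r)))
  (trans (-x+[y+0*z]≡y-x (ζ bot r) (ζ (atom i) r) (ζ top r)) (ζ-atom-ζ-bot r))
  where
  -x+[y+0*z]≡y-x : ∀ x y z → - 1ℚ * x + (y + 0ℚ * z) ≡ y - x
  -x+[y+0*z]≡y-x = solve-∀ ℚ-ring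
  x-0≡x : ∀ x → x - 0ℚ ≡ x
  x-0≡x = solve-∀ ℚ-ring
  ζ-atom-ζ-bot : ∀ r → ζ (atom i) r - ζ bot r ≡ 𝟙ᴰ (atom i) r
  ζ-atom-ζ-bot bot      = refl
  ζ-atom-ζ-bot (atom j) = x-0≡x (δ i j)
  ζ-atom-ζ-bot top      = refl
μ⊛ζ≡𝟙ᴰ {m} top bot = trans (cong (λ t → (toℚ m - 1ℚ) * 1ℚ + (t + 1ℚ * 1ℚ)) (sum-const m (- 1ℚ * 1ℚ)))
  ([M-1]+[M*-1+1]≡0 (toℚ m))
  where
  [M-1]+[M*-1+1]≡0 : ∀ M → (M - 1ℚ) * 1ℚ + (M * (- 1ℚ * 1ℚ) + 1ℚ * 1ℚ) ≡ 0ℚ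
  [M-1]+[M*-1+1]≡0 = solve-∀ ℚ-ring
μ⊛ζ≡𝟙ᴰ {m} top (atom j) = trans (cong (λ t → (toℚ m - 1ℚ) * 0ℚ + (t + 1ℚ * 1ℚ)) (sum-δʳ j (λ _ → - 1ℚ)))
  ([M-1]*0+[-1+1]≡0 (toℚ m))
  where
  [M-1]*0+[-1+1]≡0 : ∀ M → (M - 1ℚ) * 0ℚ + (- 1ℚ + 1ℚ * 1ℚ) ≡ 0ℚ
  [M-1]*0+[-1+1]≡0 = solve-∀ ℚ-ring
μ⊛ζ≡𝟙ᴰ {m} top top = trans (cong (λ t → (toℚ m - 1ℚ) * 0ℚ + (t + 1ℚ * 1ℚ)) (sum-const m (- 1ℚ * 0ℚ)))
  ([M-1]*0+[M*0+1]≡1 (toℚ m))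
  where
  [M-1]*0+[M*0+1]≡1 : ∀ M → (M - 1ℚ) * 0ℚ + (M * (- 1ℚ * 0ℚ) + 1ℚ * 1ℚ) ≡ 1ℚ
  [M-1]*0+[M*0+1]≡1 = solve-∀ ℚ-ring

Invertible-ζ : ∀ {m} → Invertible ⟦ ζ {m} ⟧
Invertible-ζ = Invertible-⟦⟧ ζ μ ζ⊛μ≡𝟙ᴰ μ⊛ζ≡𝟙ᴰ

infixr 7 _∧_
_∧_ : ∀ {m} → Diamond m → Diamond m → Diamond m
bot    ∧ _      = bot
atom i ∧ bot    = bot
atom i ∧ atom j with i Fin.≟ j
... | yes _ = atom i
... | no  _ = bot
atom i ∧ top    = atom i
top    ∧ r      = r

-- The Möbius inversion of f: Σ_{s ≤ p} Ψ f s = f p.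
Ψ : ∀ {m} → (Diamond m → ℚ) → Diamond m → ℚ
Ψ f bot      = f bot
Ψ f (atom i) = f (atom i) - f bot
Ψ f top      = f top - f bot - sum (λ i → f (atom i) - f bot)

meet-matrix≡ζΨζᵀ : ∀ {m} (f : Diamond m → ℚ) (p r : Diamond m)
  → Σᴰ (λ s → ζ p s * (ζ r s * Ψ f s)) ≡ f (p ∧ r)
meet-matrix≡ζΨζᵀ f bot r = trans (cong (λ t → 1ℚ * (ζ r bot * f bot) + (t + 0ℚ * (ζ r top * Ψ f top)))
    (sum-zero (λ k → ζ r (atom k) * Ψ f (atom k))))
  (collapse r)
  where
  1*[1*x]+[0+0*y]≡x : ∀ x y → 1ℚ * (1ℚ * x) + (0ℚ + 0ℚ * y) ≡ x
  1*[1*x]+[0+0*y]≡x = solve-∀ ℚ-ring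
  collapse : ∀ r → 1ℚ * (ζ r bot * f bot) + (0ℚ + 0ℚ * (ζ r top * Ψ f top)) ≡ f bot
  collapse bot      = 1*[1*x]+[0+0*y]≡x (f bot) (0ℚ * Ψ f top)
  collapse (atom j) = 1*[1*x]+[0+0*y]≡x (f bot) (0ℚ * Ψ f top)
  collapse top      = 1*[1*x]+[0+0*y]≡x (f bot) (1ℚ * Ψ f top)
meet-matrix≡ζΨζᵀ f (atom i) r = trans (cong (λ t → 1ℚ * (ζ r bot * f bot) + (t + 0ℚ * (ζ r top * Ψ f top)))
    (sum-δˡ i (λ k → ζ r (atom k) * Ψ f (atom k))))
  (collapse r)
  where
  fᵢ f₀ : ℚ
  fᵢ = f (atom i)
  f₀ = f bot
  1*[1*b]+[z*[a-b]+0*y]≡b+z*[a-b] : ∀ a b z y → 1ℚ * (1ℚ * b) + (z * (a - b) + 0ℚ * y) ≡ b + z * (a - b)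
  1*[1*b]+[z*[a-b]+0*y]≡b+z*[a-b] = solve-∀ ℚ-ring
  b+0*[a-b]≡b : ∀ a b → b + 0ℚ * (a - b) ≡ b
  b+0*[a-b]≡b = solve-∀ ℚ-ring
  b+1*[a-b]≡a : ∀ a b → b + 1ℚ * (a - b) ≡ a
  b+1*[a-b]≡a = solve-∀ ℚ-ring
  collapse : ∀ r → 1ℚ * (ζ r bot * f₀) + (ζ r (atom i) * (fᵢ - f₀) + 0ℚ * (ζ r top * Ψ f top)) ≡ f (atom i ∧ r)
  collapse bot = trans (1*[1*b]+[z*[a-b]+0*y]≡b+z*[a-b] fᵢ f₀ 0ℚ (0ℚ * Ψ f top)) (b+0*[a-b]≡b fᵢ f₀)
  collapse (atom j) with i Fin.≟ j
  ... | yes refl = trans (1*[1*b]+[z*[a-b]+0*y]≡b+z*[a-b] fᵢ f₀ (δ i i) (0ℚ * Ψ f top))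
                     (trans (cong (λ z → f₀ + z * (fᵢ - f₀)) (δ-refl i)) (b+1*[a-b]≡a fᵢ f₀))
  ... | no  i≢j  = trans (1*[1*b]+[z*[a-b]+0*y]≡b+z*[a-b] fᵢ f₀ (δ j i) (0ℚ * Ψ f top))
                     (trans (cong (λ z → f₀ + z * (fᵢ - f₀)) (δ-off (λ j≡i → i≢j (sym j≡i))))
                            (b+0*[a-b]≡b fᵢ f₀))
  collapse top = trans (1*[1*b]+[z*[a-b]+0*y]≡b+z*[a-b] fᵢ f₀ 1ℚ (1ℚ * Ψ f top)) (b+1*[a-b]≡a fᵢ f₀)
meet-matrix≡ζΨζᵀ f top r = trans (cong (λ t → 1ℚ * (ζ r bot * f bot) + (t + 1ℚ * (ζ r top * Ψ f top)))
    (sum-scale 1ℚ (λ k → ζ r (atom k) * Ψ f (atom k))))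
  (collapse r)
  where
  collapse : ∀ r → 1ℚ * (ζ r bot * f bot) + (1ℚ * sum (λ k → ζ r (atom k) * Ψ f (atom k))
                                              + 1ℚ * (ζ r top * Ψ f top)) ≡ f r
  collapse bot = trans
    (cong (λ t → 1ℚ * (1ℚ * f bot) + (1ℚ * t + 1ℚ * (0ℚ * Ψ f top))) (sum-zero (λ k → Ψ f (atom k))))
    (bot-identity (f bot) (Ψ f top))
    where
    bot-identity : ∀ b y → 1ℚ * (1ℚ * b) + (1ℚ * 0ℚ + 1ℚ * (0ℚ * y)) ≡ b
    bot-identity = solve-∀ ℚ-ring
  collapse (atom j) = trans
    (cong (λ t → 1ℚ * (1ℚ * f bot) + (1ℚ * t + 1ℚ * (0ℚ * Ψ f top))) (sum-δˡ j (λ k → Ψ f (atom k))))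
    (atom-identity (f (atom j)) (f bot) (Ψ f top))
    where
    atom-identity : ∀ a b y → 1ℚ * (1ℚ * b) + (1ℚ * (a - b) + 1ℚ * (0ℚ * y)) ≡ a
    atom-identity = solve-∀ ℚ-ring
  collapse top = trans
    (cong (λ t → 1ℚ * (1ℚ * f bot) + (1ℚ * t + 1ℚ * (1ℚ * Ψ f top))) (sum-scale 1ℚ (λ k → Ψ f (atom k))))
    (top-identity (f top) (f bot) (sum (λ k → f (atom k) - f bot)))
    where
    top-identity : ∀ t b S → 1ℚ * (1ℚ * b) + (1ℚ * (1ℚ * S) + 1ℚ * (1ℚ * (t - b - S))) ≡ t
    top-identity = solve-∀ ℚ-ring

Ψ-top-scaled : ∀ {m} (f : Diamond m → ℚ) (t a : ℚ) (b : Fin m → ℚ)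
  → t * f top ≡ 1ℚ → t * f bot ≡ a → (∀ i → t * f (atom i) ≡ b i)
  → t * Ψ f top ≡ (1ℚ + toℚ m * a) - (a + sum b)
Ψ-top-scaled {m} f t a b t*f⊤≡1 t*f⊥≡a t*fᵢ≡bᵢ = begin
  t * Ψ f top
    ≡⟨ distrib (f top) (f bot) S t ⟩
  t * f top - t * f bot - t * S
    ≡⟨ cong (λ u → t * f top - t * f bot - u) (sum-scale t (λ i → f (atom i) - f bot)) ⟨
  t * f top - t * f bot - sum (λ i → t * (f (atom i) - f bot))
    ≡⟨ cong₂ (λ u v → u - v - sum (λ i → t * (f (atom i) - f bot))) t*f⊤≡1 t*f⊥≡a ⟩
  1ℚ - a - sum (λ i → t * (f (atom i) - f bot))                 ≡⟨ cong (λ u → 1ℚ - a - u) (sum-cong-≗ summand) ⟩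
  1ℚ - a - sum (λ i → b i + - a)                                ≡⟨ cong (λ u → 1ℚ - a - u) (∑-distrib-+ b (λ _ → - a)) ⟩
  1ℚ - a - (sum b + sum {m} (λ _ → - a))                        ≡⟨ cong (λ u → 1ℚ - a - (sum b + u)) (sum-const m (- a)) ⟩
  1ℚ - a - (sum b + toℚ m * - a)                                ≡⟨ regroup a (sum b) (toℚ m) ⟩
  (1ℚ + toℚ m * a) - (a + sum b)                                ∎
  where
  open ≡-Reasoning
  S : ℚ
  S = sum (λ i → f (atom i) - f bot)
  distrib : ∀ u v S t → t * (u - v - S) ≡ t * u - t * v - t * S
  distrib = solve-∀ ℚ-ring
  *-distribˡ-minus : ∀ t u v → t * (u - v) ≡ t * u - t * v
  *-distribˡ-minus = solve-∀ ℚ-ring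
  summand : ∀ i → t * (f (atom i) - f bot) ≡ b i + - a
  summand i = trans (*-distribˡ-minus t (f (atom i)) (f bot)) (cong₂ _-_ (t*fᵢ≡bᵢ i) t*f⊥≡a)
  regroup : ∀ a B M → 1ℚ - a - (B + M * - a) ≡ (1ℚ + M * a) - (a + B)
  regroup = solve-∀ ℚ-ring

-- Gcd-closed diamonds

record IsGcdDiamond {m} (x : Diamond m → ℕ) : Set where
  field
    positive  : ∀ p → 0 < x p
    atom≢bot  : ∀ i → x (atom i) ≢ x bot
    atom≢top  : ∀ i → x (atom i) ≢ x top
    bot∣atom  : ∀ i → x bot ∣ x (atom i)
    gcd-atoms : ∀ i j → i ≢ j → gcd (x (atom i)) (x (atom j)) ≡ x bot
    ∣top      : ∀ p → x p ∣ x top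

module GcdDiamond {m} {x : Diamond (suc m) → ℕ} (D : IsGcdDiamond x) where
  open IsGcdDiamond D

  bot∣ : ∀ p → x bot ∣ x p
  bot∣ bot      = ∣-refl
  bot∣ (atom i) = bot∣atom i
  bot∣ top      = ∣top bot

  gcd≡meet : ∀ p r → gcd (x p) (x r) ≡ x (p ∧ r)
  gcd≡meet bot      r        = gcd-of-divisor (bot∣ r)
  gcd≡meet (atom i) bot      = trans (gcd-comm (x (atom i)) (x bot)) (gcd-of-divisor (bot∣atom i))
  gcd≡meet (atom i) (atom j) with i Fin.≟ j
  ... | yes refl = gcd-of-divisor ∣-refl
  ... | no  i≢j  = gcd-atoms i j i≢j
  gcd≡meet (atom i) top      = gcd-of-divisor (∣top (atom i))
  gcd≡meet top      r        = trans (gcd-comm (x top) (x r)) (gcd-of-divisor (∣top r))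

  X : Diamond (suc m) → ℚ
  X p = toℚ (x p)

  X≢0 : ∀ p → X p ≢ 0ℚ
  X≢0 p Xp≡0 = ℕP.<-irrefl (sym (toℚ-injective Xp≡0)) (positive p)

  f : Diamond (suc m) → ℚ
  f p = (1/ X p) {{≢-nonZero (X≢0 p)}}

  X*f≡1 : ∀ p → X p * f p ≡ 1ℚ
  X*f≡1 p = *-inverseʳ (X p) {{≢-nonZero (X≢0 p)}}

  f≡⇒X≡ : ∀ {p r} → f p ≡ f r → X p ≡ X r
  f≡⇒X≡ {p} {r} fp≡fr = begin
    X p                  ≡⟨ *-identityʳ (X p) ⟨
    X p * 1ℚ             ≡⟨ cong (X p *_) (trans (sym (X*f≡1 r)) (*-comm (X r) (f r))) ⟩
    X p * (f r * X r)    ≡⟨ cong (λ u → X p * (u * X r)) fp≡fr ⟨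
    X p * (f p * X r)    ≡⟨ *-assoc (X p) (f p) (X r) ⟨
    X p * f p * X r      ≡⟨ cong (_* X r) (X*f≡1 p) ⟩
    1ℚ * X r             ≡⟨ *-identityˡ (X r) ⟩
    X r                  ∎
    where open ≡-Reasoning

  lcm≡X*X*f[∧] : ∀ p r → toℚ (lcm (x p) (x r)) ≡ X p * X r * f (p ∧ r)
  lcm≡X*X*f[∧] p r = begin
    ℓ                             ≡⟨ *-identityˡ ℓ ⟨
    1ℚ * ℓ                        ≡⟨ cong (_* ℓ) (trans (sym (X*f≡1 (p ∧ r))) (*-comm (X (p ∧ r)) (f (p ∧ r)))) ⟩
    f (p ∧ r) * X (p ∧ r) * ℓ     ≡⟨ *-assoc (f (p ∧ r)) (X (p ∧ r)) ℓ ⟩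
    f (p ∧ r) * (X (p ∧ r) * ℓ)   ≡⟨ cong (f (p ∧ r) *_) gcd*lcm-in-ℚ ⟩
    f (p ∧ r) * (X p * X r)       ≡⟨ *-comm (f (p ∧ r)) (X p * X r) ⟩
    X p * X r * f (p ∧ r)         ∎
    where
    open ≡-Reasoning
    ℓ : ℚ
    ℓ = toℚ (lcm (x p) (x r))
    gcd*lcm-in-ℚ : X (p ∧ r) * ℓ ≡ X p * X r
    gcd*lcm-in-ℚ = trans (sym (toℚ-* (x (p ∧ r)) (lcm (x p) (x r))))
      (trans (cong toℚ (trans (cong (ℕ._* lcm (x p) (x r)) (sym (gcd≡meet p r))) (gcd*lcm (x p) (x r))))
             (toℚ-* (x p) (x r)))

  X[top]*f≡quotient : ∀ p → X top * f p ≡ toℚ (_∣_.quotient (∣top p))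
  X[top]*f≡quotient p = begin
    X top * f p              ≡⟨ cong (λ u → toℚ u * f p) (_∣_.equality (∣top p)) ⟩
    toℚ (q ℕ.* x p) * f p    ≡⟨ cong (_* f p) (toℚ-* q (x p)) ⟩
    toℚ q * X p * f p        ≡⟨ *-assoc (toℚ q) (X p) (f p) ⟩
    toℚ q * (X p * f p)      ≡⟨ cong (toℚ q *_) (X*f≡1 p) ⟩
    toℚ q * 1ℚ               ≡⟨ *-identityʳ (toℚ q) ⟩
    toℚ q                    ∎
    where
    open ≡-Reasoning
    q : ℕ
    q = _∣_.quotient (∣top p)

  Ψ≢0 : ∀ p → Ψ f p ≢ 0ℚ
  Ψ≢0 bot      f≡0 = 1≢0 (trans (sym (X*f≡1 bot)) (trans (cong (X bot *_) f≡0) (*-zeroʳ (X bot))))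
  Ψ≢0 (atom i) Ψ≡0 = atom≢bot i (toℚ-injective (f≡⇒X≡ (x∙y⁻¹≈ε⇒x≈y (f (atom i)) (f bot) Ψ≡0)))
  Ψ≢0 top      Ψ≡0 = A+ΣB≢1+m*A A B 2B≤A B≢1 (sym (toℚ-injective cleared))
    where
    A : ℕ
    A = _∣_.quotient (∣top bot)
    B : Fin (suc m) → ℕ
    B i = _∣_.quotient (∣top (atom i))
    2B≤A : ∀ i → 2 ℕ.* B i ≤ A
    2B≤A i = 2*quotient≤quotient {B = B i} {c = _∣_.quotient (bot∣atom i)} (positive (atom i)) (atom≢bot i)
      (_∣_.equality (bot∣atom i)) (_∣_.equality (∣top (atom i))) (_∣_.equality (∣top bot))
    B≢1 : ∀ i → B i ≢ 1
    B≢1 i B≡1 = atom≢top i (sym (trans (_∣_.equality (∣top (atom i)))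
      (trans (cong (ℕ._* x (atom i)) B≡1) (ℕP.*-identityˡ (x (atom i))))))
    balanced : 1ℚ + toℚ (suc m) * toℚ A ≡ toℚ A + sum (λ i → toℚ (B i))
    balanced = x∙y⁻¹≈ε⇒x≈y _ _ (begin
      (1ℚ + toℚ (suc m) * toℚ A) - (toℚ A + sum (λ i → toℚ (B i)))
        ≡⟨ Ψ-top-scaled f (X top) (toℚ A) (λ i → toℚ (B i)) (X*f≡1 top)
             (X[top]*f≡quotient bot) (λ i → X[top]*f≡quotient (atom i)) ⟨
      X top * Ψ f top   ≡⟨ cong (X top *_) Ψ≡0 ⟩
      X top * 0ℚ        ≡⟨ *-zeroʳ (X top) ⟩
      0ℚ                ∎)
      where open ≡-Reasoning
    cleared : toℚ (1 ℕ.+ suc m ℕ.* A) ≡ toℚ (A ℕ.+ ℕΣ.sum B)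
    cleared = begin
      toℚ (1 ℕ.+ suc m ℕ.* A)         ≡⟨ toℚ-+ 1 (suc m ℕ.* A) ⟩
      1ℚ + toℚ (suc m ℕ.* A)          ≡⟨ cong (1ℚ +_) (toℚ-* (suc m) A) ⟩
      1ℚ + toℚ (suc m) * toℚ A        ≡⟨ balanced ⟩
      toℚ A + sum (λ i → toℚ (B i))   ≡⟨ cong (toℚ A +_) (toℚ-sum B) ⟨
      toℚ A + toℚ (ℕΣ.sum B)          ≡⟨ toℚ-+ A (ℕΣ.sum B) ⟨
      toℚ (A ℕ.+ ℕΣ.sum B)            ∎
      where open ≡-Reasoning

  Invertible-lcmMatrix : Invertible (lcmMatrix (λ a → x (pos a)))
  Invertible-lcmMatrix = Invertible-cong lcm≐congruence
    (Invertible-congruence d (Invertible-⊗ (Invertible-diag X′ (λ a → X≢0 (pos a))) Invertible-ζ)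
                             (λ a → Ψ≢0 (pos a)))
    where
    X′ d : Fin (suc (suc (suc m))) → ℚ
    X′ a = X (pos a)
    d a = Ψ f (pos a)
    lcm≐congruence : ((diag X′ ⊗ ⟦ ζ ⟧) ⊗ diag d) ⊗ (diag X′ ⊗ ⟦ ζ ⟧) ᵀ ≐ lcmMatrix (λ a → x (pos a))
    lcm≐congruence a b = begin
      (((diag X′ ⊗ ⟦ ζ ⟧) ⊗ diag d) ⊗ (diag X′ ⊗ ⟦ ζ ⟧) ᵀ) a b
        ≡⟨ congruence-entry X′ d ⟦ ζ ⟧ a b ⟩
      X′ a * X′ b * sum (λ c → ζ (pos a) (pos c) * (ζ (pos b) (pos c) * d c))
        ≡⟨ cong (X′ a * X′ b *_) (sum-pos (λ s → ζ (pos a) s * (ζ (pos b) s * Ψ f s))) ⟩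
      X′ a * X′ b * Σᴰ (λ s → ζ (pos a) s * (ζ (pos b) s * Ψ f s))
        ≡⟨ cong (X′ a * X′ b *_) (meet-matrix≡ζΨζᵀ f (pos a) (pos b)) ⟩
      X′ a * X′ b * f (pos a ∧ pos b)     ≡⟨ lcm≡X*X*f[∧] (pos a) (pos b) ⟨
      toℚ (lcm (x (pos a)) (x (pos b)))   ∎
      where open ≡-Reasoning

corollary5p2 : (k : ℕ) → 2 ≤ k → (x : Fin (suc k) → ℕ)
    → Injective _≡_ _≡_ x
    → (∀ i → 0 < x i)
    → (∀ (i j : Fin k) → i ≢ j → gcd (x (inject₁ i)) (x (inject₁ j)) ≡ x zero)
    → lcmFin (λ i → x (inject₁ i)) ∣ x (fromℕ k)
    → Invertible (lcmMatrix x)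
corollary5p2 (suc (suc m)) (s≤s (s≤s z≤n)) x x-injective x-positive gcd≡x₁ lcm∣xₙ =
  Invertible-cong (λ a b → cong₂ (λ u v → toℚ (lcm u v)) (cong x (⌜pos⌝ a)) (cong x (⌜pos⌝ b)))
    (GcdDiamond.Invertible-lcmMatrix isGcdDiamond)
  where
  ∣xₙ : ∀ p → x ⌜ p ⌝ ∣ x ⌜ top ⌝
  ∣xₙ bot      = ∣-trans (∣lcmFin (λ i → x (inject₁ i)) zero) lcm∣xₙ
  ∣xₙ (atom i) = ∣-trans (∣lcmFin (λ i → x (inject₁ i)) (suc i)) lcm∣xₙ
  ∣xₙ top      = ∣-refl
  isGcdDiamond : IsGcdDiamond (λ p → x ⌜ p ⌝)
  isGcdDiamond = record
    { positive  = λ p → x-positive ⌜ p ⌝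
    ; atom≢bot  = λ i eq → 0≢1+n (sym (x-injective {⌜ atom i ⌝} {⌜ bot ⌝} eq))
    ; atom≢top  = λ i eq → fromℕ≢inject₁ (sym (suc-injective (x-injective {⌜ atom i ⌝} {⌜ top ⌝} eq)))
    ; bot∣atom  = λ i → subst (_∣ x ⌜ atom i ⌝) (gcd≡x₁ zero (suc i) 0≢1+n) (gcd[m,n]∣n (x zero) (x ⌜ atom i ⌝))
    ; gcd-atoms = λ i j i≢j → gcd≡x₁ (suc i) (suc j) (λ eq → i≢j (suc-injective eq))
    ; ∣top      = ∣xₙ
    }
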